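{- Let $M=(E,\rho)$ be a matroid of rank $d\ge2$ and let $0\le i\le d-2$. If $e\in E$ is a link or a coloop, then $$W_i^M(p)=(1+p)\,W_{i-b(M,e)}^{M\setminus e}(p)+W_i^{M/e}(p).$$
   Context: A link is an element that is neither a loop nor a coloop; $b(M,e):=\rho(E)-\rho(E\setminus e)$ (equal to $1$ if $e$ is a coloop, $0$ otherwise). For a matroid $N$ with rank function $\rho$, rank $d(N)$, and an integer $i$, let $\mathcal{S}_i^N=\{S\subseteq E(N):\rho(S)\ge d(N)-i\}$ ordered by inclusion, $\mathcal{L}_i^N=\{\hat0\}\oplus\mathcal{S}_i^N$ (new minimum adjoined), $\mu_i^N(S)$ the Möbius function $\mu(\hat0,S)$ of $\mathcal{L}_i^N$, and $W_i^N(p):=\sum_{S\in\mathcal{S}_i^N}\mu_i^N(S)(-p)^{\#S-d(N)+1+i}$. (In particular $W_{ -1}^N(p)=0$, as $\mathcal{S}_{ -1}^N$ is empty.) -}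

module Defs where

open import Data.Bool using (Bool; true; false; if_then_else_; _∧_)
open import Data.Nat as ℕ using (ℕ; zero; suc; _∸_)
open import Data.Integer as ℤ using (ℤ; +_; -_; _-_)
open import Data.Fin using (Fin)
open import Data.Vec using (Vec; []; _∷_; insertAt)
open import Data.List using (List; []; _∷_; map; _++_; foldr)
open import Data.Fin.Subset using (Subset; _⊆_; _∪_; _∩_; ∣_∣; ⊤; ⁅_⁆)
open import Relation.Binary.PropositionalEquality using (_≡_)
open import Relation.Nullary using (¬_)
open import Relation.Nullary.Decidable using (⌊_⌋)
open import Data.Product using (_×_)
open import Data.Sum using (_⊎_)

record Matroid (n : ℕ) : Set where
  field
    rank     : Subset n → ℕ
    rank-≤   : ∀ X → rank X ℕ.≤ ∣ X ∣
    rank-mono : ∀ {X Y} → X ⊆ Y → rank X ℕ.≤ rank Y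
    rank-submod : ∀ X Y → rank (X ∪ Y) ℕ.+ rank (X ∩ Y) ℕ.≤ rank X ℕ.+ rank Y
open Matroid public

rk : ∀ {n} → Matroid n → ℕ
rk M = rank M ⊤

-- E \ e, as a subset of Fin (suc n)
compl₁ : ∀ {n} → Fin (suc n) → Subset (suc n)
compl₁ {n} e = insertAt (⊤ {n}) e false

IsLoop : ∀ {n} → Matroid (suc n) → Fin (suc n) → Set
IsLoop M e = rank M ⁅ e ⁆ ≡ 0

IsColoop : ∀ {n} → Matroid (suc n) → Fin (suc n) → Set
IsColoop M e = ¬ (rank M (compl₁ e) ≡ rk M)

IsLink : ∀ {n} → Matroid (suc n) → Fin (suc n) → Set
IsLink M e = ¬ IsLoop M e × ¬ IsColoop M e

b : ∀ {n} → Matroid (suc n) → Fin (suc n) → ℕ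
b M e = rk M ∸ rank M (compl₁ e)

-- Rank functions of deletion and contraction.  E(M\e) = E(M/e) = E \ e,
-- identified with Fin n via the order-preserving embedding that skips e.

delRank : ∀ {n} → Matroid (suc n) → Fin (suc n) → Subset n → ℕ
delRank M e S = rank M (insertAt S e false)

conRank : ∀ {n} → Matroid (suc n) → Fin (suc n) → Subset n → ℕ
conRank M e S = rank M (insertAt S e true) ∸ rank M ⁅ e ⁆

allSubsets : (n : ℕ) → List (Subset n)
allSubsets zero = [] ∷ []
allSubsets (suc n) = map (false ∷_) (allSubsets n) ++ map (true ∷_) (allSubsets n)

_⊆ᵇ_ : ∀ {n} → Subset n → Subset n → Bool
[] ⊆ᵇ [] = true
(true ∷ xs) ⊆ᵇ (false ∷ ys) = false
(_ ∷ xs) ⊆ᵇ (_ ∷ ys) = xs ⊆ᵇ ys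

_≡ᵇ_ : ∀ {n} → Subset n → Subset n → Bool
[] ≡ᵇ [] = true
(true ∷ xs) ≡ᵇ (true ∷ ys) = xs ≡ᵇ ys
(false ∷ xs) ≡ᵇ (false ∷ ys) = xs ≡ᵇ ys
(_ ∷ xs) ≡ᵇ (_ ∷ ys) = false

_⊂ᵇ_ : ∀ {n} → Subset n → Subset n → Bool
T ⊂ᵇ S = (T ⊆ᵇ S) ∧ (if T ≡ᵇ S then false else true)

module _ {n : ℕ} (ρ : Subset n → ℕ) (i : ℤ) where

  d : ℕ
  d = ρ ⊤

  inS : Subset n → Bool
  inS S = ⌊ + d ℤ.≤? + ρ S ℤ.+ i ⌋

  sumL : List ℤ → ℤ
  sumL = foldr ℤ._+_ (+ 0)

  -- μ(0̂,S) in 𝓛_i = {0̂} ⊕ 𝒮_i, via the defining recursion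
  --   μ(0̂,S) = - μ(0̂,0̂) - Σ_{T ∈ 𝒮_i, T ⊊ S} μ(0̂,T),   μ(0̂,0̂) = 1,
  -- computed with fuel k; correct whenever k ≥ ∣ S ∣ (strict subsets are smaller).
  μAux : ℕ → Subset n → ℤ
  μAux zero S = - + 1
  μAux (suc k) S =
    - + 1 - sumL (map (λ T → if inS T ∧ (T ⊂ᵇ S) then μAux k T else + 0) (allSubsets n))

  μ : Subset n → ℤ
  μ S = μAux ∣ S ∣ S

  -- exponent #S - d + 1 + i  (≥ 1 for S ∈ 𝒮_i, so ∣_∣ is exact there)
  expo : Subset n → ℕ
  expo S = ℤ.∣ + ∣ S ∣ - + d ℤ.+ + 1 ℤ.+ i ∣

  W : ℤ → ℤ
  W p = sumL (map (λ S → if inS S then μ S ℤ.* ((- p) ℤ.^ expo S) else + 0) (allSubsets n))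

-- Split the sum defining W_i^M(p) according to whether S contains e.  For
-- S ∌ e the conditions ρ(S) ≥ d(M) - i and ρ_{M∖e}(S) ≥ d(M∖e) - (i - b)
-- agree, and so do the exponents.  For S ∋ e, since e is not a loop,
-- ρ(S) ≥ d(M) - i iff ρ_{M/e}(S∖e) ≥ d(M/e) - i.  The Möbius function
-- of {0̂} ⊕ 𝒮 for an up-set 𝒮 of the Boolean lattice has the closed form
-- μ(0̂,S) = - Σ_{T ∈ 𝒮, T ⊆ S} (-1)^(|S|-|T|), which satisfies the defining
-- recursion because Σ_{R ⊆ T ⊆ S} (-1)^|T| vanishes unless R = S.
-- Splitting this sum over T ∌ e and T ∋ e gives μ_i^M(S) = μ_{i-b}^{M∖e}(S)
-- for S ∌ e and μ_i^M(S + e) = μ_i^{M/e}(S) - μ_{i-b}^{M∖e}(S).  The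
-- subtracted term carries an exponent one larger than in W_{i-b}^{M∖e},
-- whence the factor p in (1 + p).
module Submission where

open import Defs

module DeletionContraction where

  open import Data.Bool using (Bool; true; false; if_then_else_; _∧_)
  open import Data.Bool.Properties using (∧-zeroʳ; ∧-identityʳ; T-≡)
  open import Data.Fin using (Fin; zero; suc)
  open import Data.Fin.Subset using (Subset; _⊆_; ∣_∣; ⊤; ⁅_⁆; _∪_; _∩_)
  open import Data.Fin.Subset.Properties using (p⊆q⇒∣p∣≤∣q∣; ⊆⊤; ∪-identityʳ; ∣⁅x⁆∣≡1; x∈⁅y⁆⇒x≡y)
  open import Data.Integer as ℤ using (ℤ; +_; -_; _+_; _-_; _*_; _^_; 0ℤ; 1ℤ; +≤+)
  import Data.Integer.Properties as ℤₚ
  open import Algebra.Properties.CommutativeSemigroup ℤₚ.+-commutativeSemigroup using (interchange)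
  open import Data.Integer.Solver using (module +-*-Solver)
  open import Data.List using (List; []; _∷_; map; _++_; foldr)
  open import Data.Nat as ℕ using (ℕ; zero; suc; _≤_; _<_; z≤n; s≤s)
  import Data.Nat.Properties as ℕₚ
  open import Data.Product using (_×_; _,_)
  open import Data.Sum using (_⊎_; inj₁; inj₂)
  open import Data.Vec using ([]; _∷_; insertAt; here; there)
  open import Data.Vec.Properties using (lookup⇒[]=; insertAt-lookup)
  open import Function using (_∘_)
  open import Function.Bundles using (Equivalence)
  open import Relation.Binary.PropositionalEquality
  open import Relation.Nullary using (¬_; contradiction; yes; no)
  open import Relation.Nullary.Decidable using (⌊_⌋; isYes≗does; dec-true; toWitness)
  open +-*-Solver

  ∑ : {A : Set} → List A → (A → ℤ) → ℤ
  ∑ xs f = foldr _+_ 0ℤ (map f xs)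

  module _ {A : Set} where

    ∑-++ : ∀ xs ys (f : A → ℤ) → ∑ (xs ++ ys) f ≡ ∑ xs f + ∑ ys f
    ∑-++ []       ys f = sym (ℤₚ.+-identityˡ _)
    ∑-++ (x ∷ xs) ys f = trans (cong (_+_ (f x)) (∑-++ xs ys f)) (sym (ℤₚ.+-assoc (f x) _ _))

    ∑-cong : ∀ xs {f g : A → ℤ} → (∀ x → f x ≡ g x) → ∑ xs f ≡ ∑ xs g
    ∑-cong []       f≗g = refl
    ∑-cong (x ∷ xs) f≗g = cong₂ _+_ (f≗g x) (∑-cong xs f≗g)

    ∑-zero : ∀ xs {f : A → ℤ} → (∀ x → f x ≡ 0ℤ) → ∑ xs f ≡ 0ℤ
    ∑-zero []       f≗0 = refl
    ∑-zero (x ∷ xs) f≗0 = cong₂ _+_ (f≗0 x) (∑-zero xs f≗0)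

    ∑-+ : ∀ xs (f g : A → ℤ) → ∑ xs (λ x → f x + g x) ≡ ∑ xs f + ∑ xs g
    ∑-+ []       f g = refl
    ∑-+ (x ∷ xs) f g = trans (cong (_+_ (f x + g x)) (∑-+ xs f g)) (interchange (f x) (g x) _ _)

    ∑-*ˡ : ∀ xs c (f : A → ℤ) → ∑ xs (λ x → c * f x) ≡ c * ∑ xs f
    ∑-*ˡ []       c f = sym (ℤₚ.*-zeroʳ c)
    ∑-*ˡ (x ∷ xs) c f = trans (cong (_+_ (c * f x)) (∑-*ˡ xs c f)) (sym (ℤₚ.*-distribˡ-+ c (f x) _))

    ∑-neg : ∀ xs (f : A → ℤ) → ∑ xs (λ x → - f x) ≡ - ∑ xs f
    ∑-neg []       f = refl
    ∑-neg (x ∷ xs) f = trans (cong (_+_ (- f x)) (∑-neg xs f)) (sym (ℤₚ.neg-distrib-+ (f x) _))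

    ∑-difference : ∀ xs (f g : A → ℤ) → ∑ xs (λ x → f x - g x) ≡ ∑ xs f - ∑ xs g
    ∑-difference xs f g = trans (∑-+ xs f (λ x → - g x)) (cong (_+_ (∑ xs f)) (∑-neg xs g))

  ∑-swap : ∀ {A B : Set} xs (ys : List B) (h : A → B → ℤ) →
           ∑ xs (λ x → ∑ ys (h x)) ≡ ∑ ys (λ y → ∑ xs (λ x → h x y))
  ∑-swap []       ys h = sym (∑-zero ys (λ _ → refl))
  ∑-swap (x ∷ xs) ys h = trans (cong (_+_ (∑ ys (h x))) (∑-swap xs ys h)) (sym (∑-+ ys (h x) _))

  ∑-map : ∀ {A B : Set} xs (g : A → B) (f : B → ℤ) → ∑ (map g xs) f ≡ ∑ xs (f ∘ g)
  ∑-map []       g f = refl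
  ∑-map (x ∷ xs) g f = cong (_+_ (f (g x))) (∑-map xs g f)

  ∑ˢ : ∀ {n} → (Subset n → ℤ) → ℤ
  ∑ˢ {n} = ∑ (allSubsets n)

  ∑ˢ-∷ : ∀ {n} (f : Subset (suc n) → ℤ) → ∑ˢ f ≡ ∑ˢ (f ∘ (false ∷_)) + ∑ˢ (f ∘ (true ∷_))
  ∑ˢ-∷ {n} f = trans (∑-++ (map (false ∷_) (allSubsets n)) _ f)
    (cong₂ _+_ (∑-map (allSubsets n) (false ∷_) f) (∑-map (allSubsets n) (true ∷_) f))

  ∑ˢ-insertAt : ∀ {n} (e : Fin (suc n)) (f : Subset (suc n) → ℤ) →
                ∑ˢ f ≡ ∑ˢ (λ S → f (insertAt S e false)) + ∑ˢ (λ S → f (insertAt S e true))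
  ∑ˢ-insertAt         zero    f = ∑ˢ-∷ f
  ∑ˢ-insertAt {suc n} (suc e) f = begin
    ∑ˢ f                                      ≡⟨ ∑ˢ-∷ f ⟩
    ∑ˢ (f ∘ (false ∷_)) + ∑ˢ (f ∘ (true ∷_))  ≡⟨ cong₂ _+_ (∑ˢ-insertAt e _) (∑ˢ-insertAt e _) ⟩
    (f₀₀ + f₀₁) + (f₁₀ + f₁₁)                 ≡⟨ interchange f₀₀ f₀₁ f₁₀ f₁₁ ⟩
    (f₀₀ + f₁₀) + (f₀₁ + f₁₁)                 ≡⟨ sym (cong₂ _+_ (∑ˢ-∷ f₀) (∑ˢ-∷ f₁)) ⟩
    ∑ˢ f₀ + ∑ˢ f₁                             ∎
    where
    open ≡-Reasoning
    f₀ f₁ : Subset (suc n) → ℤ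
    f₀ S = f (insertAt S (suc e) false)
    f₁ S = f (insertAt S (suc e) true)
    f₀₀ f₀₁ f₁₀ f₁₁ : ℤ
    f₀₀ = ∑ˢ (λ S → f (false ∷ insertAt S e false))
    f₀₁ = ∑ˢ (λ S → f (false ∷ insertAt S e true))
    f₁₀ = ∑ˢ (λ S → f (true ∷ insertAt S e false))
    f₁₁ = ∑ˢ (λ S → f (true ∷ insertAt S e true))

  [_]·_ : Bool → ℤ → ℤ
  [ c ]· x = if c then x else 0ℤ

  []·-cong : ∀ {c c′ x y} → c ≡ c′ → (c′ ≡ true → x ≡ y) → [ c ]· x ≡ [ c′ ]· y
  []·-cong {c′ = true}  refl x≡y = x≡y refl
  []·-cong {c′ = false} refl x≡y = refl

  []·-zero : ∀ c → [ c ]· 0ℤ ≡ 0ℤ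
  []·-zero true  = refl
  []·-zero false = refl

  []·-neg : ∀ c x → - ([ c ]· x) ≡ [ c ]· (- x)
  []·-neg true  x = refl
  []·-neg false x = refl

  *-[]· : ∀ c x y → x * [ c ]· y ≡ [ c ]· (x * y)
  *-[]· true  x y = refl
  *-[]· false x y = ℤₚ.*-zeroʳ x

  []·-comm : ∀ c c′ x → [ c ]· ([ c′ ]· x) ≡ [ c′ ]· ([ c ]· x)
  []·-comm true  c′    x = refl
  []·-comm false true  x = refl
  []·-comm false false x = refl

  []·-*-transpose : ∀ c u d a b → [ c ]· (a * [ u ∧ d ]· b) ≡ [ u ]· (b * [ d ∧ c ]· a)
  []·-*-transpose true  true  true  a b = ℤₚ.*-comm a b
  []·-*-transpose true  true  false a b = trans (ℤₚ.*-zeroʳ a) (sym (ℤₚ.*-zeroʳ b))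
  []·-*-transpose true  false d     a b = ℤₚ.*-zeroʳ a
  []·-*-transpose false true  true  a b = sym (ℤₚ.*-zeroʳ b)
  []·-*-transpose false true  false a b = sym (ℤₚ.*-zeroʳ b)
  []·-*-transpose false false d     a b = refl

  []·-∧-exclude : ∀ a c e x → (e ≡ true → a ≡ true × c ≡ true) →
                  [ a ∧ (c ∧ (if e then false else true)) ]· x ≡ [ a ∧ c ]· x - [ e ]· x
  []·-∧-exclude true  true  false x _ = sym (ℤₚ.+-identityʳ x)
  []·-∧-exclude true  false false x _ = refl
  []·-∧-exclude false c     false x _ = refl
  []·-∧-exclude a     c     true  x e⇒a∧c with e⇒a∧c refl
  ... | refl , refl = sym (ℤₚ.+-inverseʳ x)

  ∑-[]· : ∀ {A : Set} xs c (f : A → ℤ) → ∑ xs (λ x → [ c ]· f x) ≡ [ c ]· ∑ xs f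
  ∑-[]· xs true  f = refl
  ∑-[]· xs false f = ∑-zero xs (λ _ → refl)

  ⊆ᵇ-refl : ∀ {n} (S : Subset n) → S ⊆ᵇ S ≡ true
  ⊆ᵇ-refl []          = refl
  ⊆ᵇ-refl (false ∷ S) = ⊆ᵇ-refl S
  ⊆ᵇ-refl (true  ∷ S) = ⊆ᵇ-refl S

  ≡ᵇ⇒≡ : ∀ {n} (T S : Subset n) → T ≡ᵇ S ≡ true → T ≡ S
  ≡ᵇ⇒≡ []          []          _   = refl
  ≡ᵇ⇒≡ (false ∷ T) (false ∷ S) T≡S = cong (false ∷_) (≡ᵇ⇒≡ T S T≡S)
  ≡ᵇ⇒≡ (true  ∷ T) (true  ∷ S) T≡S = cong (true ∷_) (≡ᵇ⇒≡ T S T≡S)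
  ≡ᵇ⇒≡ (false ∷ T) (true  ∷ S) ()
  ≡ᵇ⇒≡ (true  ∷ T) (false ∷ S) ()

  ⊆ᵇ⇒⊆ : ∀ {n} (R T : Subset n) → R ⊆ᵇ T ≡ true → R ⊆ T
  ⊆ᵇ⇒⊆ (true ∷ R) (true  ∷ T) R⊆T here      = here
  ⊆ᵇ⇒⊆ (true ∷ R) (false ∷ T) ()  here
  ⊆ᵇ⇒⊆ (r    ∷ R) (t     ∷ T) R⊆T (there x) = there (⊆ᵇ⇒⊆ R T (drop r t R⊆T) x)
    where
    drop : ∀ r t → (r ∷ R) ⊆ᵇ (t ∷ T) ≡ true → R ⊆ᵇ T ≡ true
    drop false t     h = h
    drop true  true  h = h
    drop true  false ()

  ⊂ᵇ⇒∣∣< : ∀ {n} (T S : Subset n) → T ⊂ᵇ S ≡ true → ∣ T ∣ < ∣ S ∣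
  ⊂ᵇ⇒∣∣< []          []          ()
  ⊂ᵇ⇒∣∣< (false ∷ T) (false ∷ S) T⊂S = ⊂ᵇ⇒∣∣< T S T⊂S
  ⊂ᵇ⇒∣∣< (true  ∷ T) (true  ∷ S) T⊂S = s≤s (⊂ᵇ⇒∣∣< T S T⊂S)
  ⊂ᵇ⇒∣∣< (false ∷ T) (true  ∷ S) T⊂S =
    s≤s (p⊆q⇒∣p∣≤∣q∣ (⊆ᵇ⇒⊆ T S (trans (sym (∧-identityʳ _)) T⊂S)))
  ⊂ᵇ⇒∣∣< (true  ∷ T) (false ∷ S) ()

  ∑-[≡ᵇ] : ∀ {n} (S : Subset n) (h : Subset n → ℤ) → ∑ˢ (λ T → [ T ≡ᵇ S ]· h T) ≡ h S
  ∑-[≡ᵇ]         []          h = ℤₚ.+-identityʳ (h [])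
  ∑-[≡ᵇ] {suc n} (false ∷ S) h = trans (∑ˢ-∷ (λ T → [ T ≡ᵇ (false ∷ S) ]· h T))
    (trans (cong₂ _+_ (∑-[≡ᵇ] S (h ∘ (false ∷_))) (∑-zero (allSubsets n) (λ _ → refl)))
           (ℤₚ.+-identityʳ _))
  ∑-[≡ᵇ] {suc n} (true  ∷ S) h = trans (∑ˢ-∷ (λ T → [ T ≡ᵇ (true ∷ S) ]· h T))
    (trans (cong₂ _+_ (∑-zero (allSubsets n) (λ _ → refl)) (∑-[≡ᵇ] S (h ∘ (true ∷_))))
           (ℤₚ.+-identityˡ _))

  sign : ∀ {n} → Subset n → ℤ
  sign []          = 1ℤ
  sign (false ∷ S) = sign S
  sign (true  ∷ S) = - sign S

  sign*sign≡1 : ∀ {n} (S : Subset n) → sign S * sign S ≡ 1ℤ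
  sign*sign≡1 []          = refl
  sign*sign≡1 (false ∷ S) = sign*sign≡1 S
  sign*sign≡1 (true  ∷ S) = trans (solve 1 (λ a → (:- a) :* (:- a) := a :* a) refl (sign S)) (sign*sign≡1 S)

  ∑-sign-interval : ∀ {n} (R S : Subset n) →
                    ∑ˢ (λ T → [ (R ⊆ᵇ T) ∧ (T ⊆ᵇ S) ]· sign T) ≡ [ R ≡ᵇ S ]· sign S
  ∑-sign-interval         []      []      = refl
  ∑-sign-interval {suc n} (r ∷ R) (s ∷ S) =
    trans (∑ˢ-∷ (λ T → [ ((r ∷ R) ⊆ᵇ T) ∧ (T ⊆ᵇ (s ∷ S)) ]· sign T)) (by-heads r s)
    where
    interval : ℤ
    interval = ∑ˢ (λ T → [ (R ⊆ᵇ T) ∧ (T ⊆ᵇ S) ]· sign T)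

    none : ∑ˢ (λ T → [ (R ⊆ᵇ T) ∧ false ]· (- sign T)) ≡ 0ℤ
    none = ∑-zero (allSubsets n) (λ T → cong (λ c → [ c ]· (- sign T)) (∧-zeroʳ (R ⊆ᵇ T)))

    negated : ∑ˢ (λ T → [ (R ⊆ᵇ T) ∧ (T ⊆ᵇ S) ]· (- sign T)) ≡ - interval
    negated = trans (sym (∑-cong (allSubsets n) (λ T → []·-neg _ (sign T)))) (∑-neg (allSubsets n) _)

    by-heads : ∀ r s →
      ∑ˢ (λ T → [ ((r ∷ R) ⊆ᵇ (false ∷ T)) ∧ ((false ∷ T) ⊆ᵇ (s ∷ S)) ]· sign T) +
      ∑ˢ (λ T → [ ((r ∷ R) ⊆ᵇ (true ∷ T)) ∧ ((true ∷ T) ⊆ᵇ (s ∷ S)) ]· (- sign T))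
        ≡ [ (r ∷ R) ≡ᵇ (s ∷ S) ]· sign (s ∷ S)
    by-heads false false = trans (cong₂ _+_ (∑-sign-interval R S) none) (ℤₚ.+-identityʳ _)
    by-heads false true  = trans (cong (_+_ interval) negated) (ℤₚ.+-inverseʳ interval)
    by-heads true  false = cong₂ _+_ (∑-zero (allSubsets n) (λ _ → refl)) none
    by-heads true  true  = begin
      ∑ˢ {n} (λ _ → 0ℤ) + ∑ˢ (λ T → [ (R ⊆ᵇ T) ∧ (T ⊆ᵇ S) ]· (- sign T))
        ≡⟨ cong₂ _+_ (∑-zero (allSubsets n) (λ _ → refl)) negated ⟩
      0ℤ + - interval
        ≡⟨ ℤₚ.+-identityˡ _ ⟩
      - interval
        ≡⟨ cong -_ (∑-sign-interval R S) ⟩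
      - ([ R ≡ᵇ S ]· sign S)
        ≡⟨ []·-neg (R ≡ᵇ S) (sign S) ⟩
      [ R ≡ᵇ S ]· (- sign S) ∎
      where open ≡-Reasoning

  UpClosed : ∀ {n} → (Subset n → Bool) → Set
  UpClosed u = ∀ {R T} → u R ≡ true → R ⊆ᵇ T ≡ true → u T ≡ true

  signedCount : ∀ {n} → (Subset n → Bool) → Subset n → ℤ
  signedCount u S = ∑ˢ (λ T → [ u T ∧ (T ⊆ᵇ S) ]· sign T)

  μ′ : ∀ {n} → (Subset n → Bool) → Subset n → ℤ
  μ′ u S = - (sign S * signedCount u S)

  μ′-cong : ∀ {n} {u v : Subset n → Bool} → (∀ T → u T ≡ v T) → ∀ S → μ′ u S ≡ μ′ v S
  μ′-cong {n} u≗v S = cong (λ z → - (sign S * z))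
    (∑-cong (allSubsets n) (λ T → cong (λ c → [ c ∧ (T ⊆ᵇ S) ]· sign T) (u≗v T)))

  module _ {n} {u : Subset n → Bool} (up : UpClosed u) where

    μ′-outside : ∀ {S} → u S ≡ false → μ′ u S ≡ 0ℤ
    μ′-outside {S} ¬uS =
      trans (cong (λ z → - (sign S * z)) (∑-zero (allSubsets n) below)) (cong -_ (ℤₚ.*-zeroʳ (sign S)))
      where
      below : ∀ T → [ u T ∧ (T ⊆ᵇ S) ]· sign T ≡ 0ℤ
      below T with u T in uT | T ⊆ᵇ S in T⊆S
      ... | false | _     = refl
      ... | true  | false = refl
      ... | true  | true  = contradiction (trans (sym (up uT T⊆S)) ¬uS) λ ()

    ∑-μ′-below : ∀ {S} → u S ≡ true → ∑ˢ (λ T → [ u T ∧ (T ⊆ᵇ S) ]· μ′ u T) ≡ - 1ℤ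
    ∑-μ′-below {S} uS = begin
      ∑ˢ (λ T → [ u T ∧ (T ⊆ᵇ S) ]· μ′ u T)
        ≡⟨ ∑-cong all (λ T → trans (restrict T) (expand T)) ⟩
      ∑ˢ (λ T → - ∑ˢ (λ R → term R T))
        ≡⟨ ∑-neg all _ ⟩
      - ∑ˢ (λ T → ∑ˢ (λ R → term R T))
        ≡⟨ cong -_ (∑-swap all all _) ⟩
      - ∑ˢ (λ R → ∑ˢ (λ T → term R T))
        ≡⟨ cong -_ (∑-cong all collapse) ⟩
      - ∑ˢ (λ R → [ R ≡ᵇ S ]· ([ u R ]· (sign R * sign S)))
        ≡⟨ cong -_ (∑-[≡ᵇ] S _) ⟩
      - ([ u S ]· (sign S * sign S))
        ≡⟨ cong (λ c → - ([ c ]· (sign S * sign S))) uS ⟩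
      - (sign S * sign S)
        ≡⟨ cong -_ (sign*sign≡1 S) ⟩
      - 1ℤ ∎
      where
      open ≡-Reasoning
      all : List (Subset n)
      all = allSubsets n

      term : Subset n → Subset n → ℤ
      term R T = [ u R ]· (sign R * [ (R ⊆ᵇ T) ∧ (T ⊆ᵇ S) ]· sign T)

      restrict : ∀ T → [ u T ∧ (T ⊆ᵇ S) ]· μ′ u T ≡ [ T ⊆ᵇ S ]· μ′ u T
      restrict T with u T in uT
      ... | true  = refl
      ... | false = sym (trans (cong ([ T ⊆ᵇ S ]·_) (μ′-outside uT)) ([]·-zero (T ⊆ᵇ S)))

      expand : ∀ T → [ T ⊆ᵇ S ]· μ′ u T ≡ - ∑ˢ (λ R → term R T)
      expand T = begin
        [ T ⊆ᵇ S ]· μ′ u T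
          ≡⟨ sym ([]·-neg (T ⊆ᵇ S) _) ⟩
        - ([ T ⊆ᵇ S ]· (sign T * signedCount u T))
          ≡⟨ cong (λ z → - ([ T ⊆ᵇ S ]· z)) (sym (∑-*ˡ all (sign T) _)) ⟩
        - ([ T ⊆ᵇ S ]· ∑ˢ (λ R → sign T * [ u R ∧ (R ⊆ᵇ T) ]· sign R))
          ≡⟨ cong -_ (sym (∑-[]· all (T ⊆ᵇ S) _)) ⟩
        - ∑ˢ (λ R → [ T ⊆ᵇ S ]· (sign T * [ u R ∧ (R ⊆ᵇ T) ]· sign R))
          ≡⟨ cong -_ (∑-cong all (λ R → []·-*-transpose (T ⊆ᵇ S) (u R) (R ⊆ᵇ T) (sign T) (sign R))) ⟩
        - ∑ˢ (λ R → term R T) ∎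

      collapse : ∀ R → ∑ˢ (λ T → term R T) ≡ [ R ≡ᵇ S ]· ([ u R ]· (sign R * sign S))
      collapse R = begin
        ∑ˢ (λ T → term R T)
          ≡⟨ ∑-[]· all (u R) _ ⟩
        [ u R ]· ∑ˢ (λ T → sign R * [ (R ⊆ᵇ T) ∧ (T ⊆ᵇ S) ]· sign T)
          ≡⟨ cong ([ u R ]·_) (∑-*ˡ all (sign R) _) ⟩
        [ u R ]· (sign R * ∑ˢ (λ T → [ (R ⊆ᵇ T) ∧ (T ⊆ᵇ S) ]· sign T))
          ≡⟨ cong (λ z → [ u R ]· (sign R * z)) (∑-sign-interval R S) ⟩
        [ u R ]· (sign R * [ R ≡ᵇ S ]· sign S)
          ≡⟨ cong ([ u R ]·_) (*-[]· (R ≡ᵇ S) (sign R) (sign S)) ⟩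
        [ u R ]· ([ R ≡ᵇ S ]· (sign R * sign S))
          ≡⟨ []·-comm (u R) (R ≡ᵇ S) _ ⟩
        [ R ≡ᵇ S ]· ([ u R ]· (sign R * sign S)) ∎

    ∑-μ′-strictlyBelow : ∀ {S} → u S ≡ true →
                         ∑ˢ (λ T → [ u T ∧ (T ⊂ᵇ S) ]· μ′ u T) ≡ - 1ℤ - μ′ u S
    ∑-μ′-strictlyBelow {S} uS = begin
      ∑ˢ (λ T → [ u T ∧ (T ⊂ᵇ S) ]· μ′ u T)
        ≡⟨ ∑-cong (allSubsets n) exclude-S ⟩
      ∑ˢ (λ T → [ u T ∧ (T ⊆ᵇ S) ]· μ′ u T - [ T ≡ᵇ S ]· μ′ u T)
        ≡⟨ ∑-difference (allSubsets n) _ _ ⟩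
      ∑ˢ (λ T → [ u T ∧ (T ⊆ᵇ S) ]· μ′ u T) - ∑ˢ (λ T → [ T ≡ᵇ S ]· μ′ u T)
        ≡⟨ cong₂ _-_ (∑-μ′-below uS) (∑-[≡ᵇ] S (μ′ u)) ⟩
      - 1ℤ - μ′ u S ∎
      where
      open ≡-Reasoning
      exclude-S : ∀ T → [ u T ∧ (T ⊂ᵇ S) ]· μ′ u T ≡ [ u T ∧ (T ⊆ᵇ S) ]· μ′ u T - [ T ≡ᵇ S ]· μ′ u T
      exclude-S T = []·-∧-exclude (u T) (T ⊆ᵇ S) (T ≡ᵇ S) (μ′ u T) T≡S⇒
        where
        T≡S⇒ : T ≡ᵇ S ≡ true → u T ≡ true × T ⊆ᵇ S ≡ true
        T≡S⇒ T≡ᵇS with refl ← ≡ᵇ⇒≡ T S T≡ᵇS = uS , ⊆ᵇ-refl S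

  module _ {n} (ρ : Subset n → ℕ) (i : ℤ) (up : UpClosed (inS ρ i)) where

    μAux≡μ′ : ∀ k S → inS ρ i S ≡ true → ∣ S ∣ ≤ k → μAux ρ i k S ≡ μ′ (inS ρ i) S
    μAux≡μ′ k S uS ∣S∣≤k = begin
      μAux ρ i k S
        ≡⟨ unfold k ∣S∣≤k ⟩
      - 1ℤ - ∑ˢ (λ T → [ u T ∧ (T ⊂ᵇ S) ]· μ′ u T)
        ≡⟨ cong (_-_ (- 1ℤ)) (∑-μ′-strictlyBelow {u = u} up uS) ⟩
      - 1ℤ - (- 1ℤ - μ′ u S)
        ≡⟨ solve 1 (λ m → :- con 1ℤ :- (:- con 1ℤ :- m) := m) refl (μ′ u S) ⟩
      μ′ u S ∎
      where
      open ≡-Reasoning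
      u : Subset n → Bool
      u = inS ρ i

      unfold : ∀ k → ∣ S ∣ ≤ k → μAux ρ i k S ≡ - 1ℤ - ∑ˢ (λ T → [ u T ∧ (T ⊂ᵇ S) ]· μ′ u T)
      unfold zero ∣S∣≤0 =
        sym (trans (cong (_-_ (- 1ℤ)) (∑-zero (allSubsets n) none)) (ℤₚ.+-identityʳ _))
        where
        none : ∀ T → [ u T ∧ (T ⊂ᵇ S) ]· μ′ u T ≡ 0ℤ
        none T with u T | T ⊂ᵇ S in T⊂S
        ... | false | _     = refl
        ... | true  | false = refl
        ... | true  | true  = contradiction (ℕₚ.<-≤-trans (⊂ᵇ⇒∣∣< T S T⊂S) ∣S∣≤0) ℕₚ.n≮0
      unfold (suc k) ∣S∣≤1+k = cong (_-_ (- 1ℤ)) (∑-cong (allSubsets n) smaller)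
        where
        smaller : ∀ T → [ u T ∧ (T ⊂ᵇ S) ]· μAux ρ i k T ≡ [ u T ∧ (T ⊂ᵇ S) ]· μ′ u T
        smaller T with u T in uT | T ⊂ᵇ S in T⊂S
        ... | false | _     = refl
        ... | true  | false = refl
        ... | true  | true  =
          μAux≡μ′ k T uT (ℕₚ.≤-pred (ℕₚ.<-≤-trans (⊂ᵇ⇒∣∣< T S T⊂S) ∣S∣≤1+k))

    μ≡μ′ : ∀ S → inS ρ i S ≡ true → μ ρ i S ≡ μ′ (inS ρ i) S
    μ≡μ′ S uS = μAux≡μ′ ∣ S ∣ S uS ℕₚ.≤-refl

  inS-upClosed : ∀ {n} (ρ : Subset n → ℕ) → (∀ {R T} → R ⊆ᵇ T ≡ true → ρ R ≤ ρ T) →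
                 ∀ i → UpClosed (inS ρ i)
  inS-upClosed ρ mono i {R} {T} uR R⊆T =
    trans (isYes≗does _) (dec-true (_ ℤ.≤? _) (ℤₚ.≤-trans d≤ρR+i (ℤₚ.+-monoˡ-≤ i (+≤+ (mono R⊆T)))))
    where
    d≤ρR+i : + ρ ⊤ ℤ.≤ + ρ R + i
    d≤ρR+i = toWitness (Equivalence.from T-≡ uR)

  ≤-by-difference : ∀ {x y x′ y′} → x - y ≡ x′ - y′ → x ℤ.≤ y → x′ ℤ.≤ y′
  ≤-by-difference x-y≡x′-y′ x≤y =
    ℤₚ.i-j≤0⇒i≤j (subst (ℤ._≤ 0ℤ) x-y≡x′-y′ (ℤₚ.i≤j⇒i-j≤0 x≤y))

  ≤?-by-difference : ∀ {x y x′ y′} → x - y ≡ x′ - y′ → ⌊ x ℤ.≤? y ⌋ ≡ ⌊ x′ ℤ.≤? y′ ⌋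
  ≤?-by-difference {x} {y} {x′} {y′} eq with x ℤ.≤? y | x′ ℤ.≤? y′
  ... | yes _   | yes _     = refl
  ... | no  _   | no  _     = refl
  ... | yes x≤y | no  x′≰y′ = contradiction (≤-by-difference eq x≤y) x′≰y′
  ... | no  x≰y | yes x′≤y′ = contradiction (≤-by-difference (sym eq) x′≤y′) x≰y

  ∣i+1∣≡1+∣i∣ : ∀ {i} → 0ℤ ℤ.≤ i → ℤ.∣ i + 1ℤ ∣ ≡ suc ℤ.∣ i ∣
  ∣i+1∣≡1+∣i∣ {+ k} _ = ℕₚ.+-comm k 1

  ⊆ᵇ-insertAt : ∀ {n} (R S : Subset n) e x y →
                insertAt R e x ⊆ᵇ insertAt S e y ≡ (if x then y else true) ∧ (R ⊆ᵇ S)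
  ⊆ᵇ-insertAt R           S           zero    false y     = refl
  ⊆ᵇ-insertAt R           S           zero    true  false = refl
  ⊆ᵇ-insertAt R           S           zero    true  true  = refl
  ⊆ᵇ-insertAt (false ∷ R) (s ∷ S)     (suc e) x     y     = ⊆ᵇ-insertAt R S e x y
  ⊆ᵇ-insertAt (true  ∷ R) (true  ∷ S) (suc e) x     y     = ⊆ᵇ-insertAt R S e x y
  ⊆ᵇ-insertAt (true  ∷ R) (false ∷ S) (suc e) x     y     = sym (∧-zeroʳ _)

  sign-insertAt-false : ∀ {n} (S : Subset n) e → sign (insertAt S e false) ≡ sign S
  sign-insertAt-false S           zero    = refl
  sign-insertAt-false (false ∷ S) (suc e) = sign-insertAt-false S e
  sign-insertAt-false (true  ∷ S) (suc e) = cong -_ (sign-insertAt-false S e)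

  sign-insertAt-true : ∀ {n} (S : Subset n) e → sign (insertAt S e true) ≡ - sign S
  sign-insertAt-true S           zero    = refl
  sign-insertAt-true (false ∷ S) (suc e) = sign-insertAt-true S e
  sign-insertAt-true (true  ∷ S) (suc e) = cong -_ (sign-insertAt-true S e)

  ∣insertAt-false∣ : ∀ {n} (S : Subset n) e → ∣ insertAt S e false ∣ ≡ ∣ S ∣
  ∣insertAt-false∣ S           zero    = refl
  ∣insertAt-false∣ (false ∷ S) (suc e) = ∣insertAt-false∣ S e
  ∣insertAt-false∣ (true  ∷ S) (suc e) = cong suc (∣insertAt-false∣ S e)

  ∣insertAt-true∣ : ∀ {n} (S : Subset n) e → ∣ insertAt S e true ∣ ≡ suc ∣ S ∣
  ∣insertAt-true∣ S           zero    = refl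
  ∣insertAt-true∣ (false ∷ S) (suc e) = ∣insertAt-true∣ S e
  ∣insertAt-true∣ (true  ∷ S) (suc e) = cong suc (∣insertAt-true∣ S e)

  insertAt-⊤ : ∀ {n} (e : Fin (suc n)) → insertAt ⊤ e true ≡ ⊤
  insertAt-⊤         zero    = refl
  insertAt-⊤ {suc n} (suc e) = cong (true ∷_) (insertAt-⊤ e)

  module Insertion {n} (e : Fin (suc n)) where

    infix 25 _⁻ _⁺
    _⁻ _⁺ : Subset n → Subset (suc n)
    S ⁻ = insertAt S e false
    S ⁺ = insertAt S e true

    signedCount-⁻ : ∀ u S → signedCount u (S ⁻) ≡ signedCount (λ T → u (T ⁻)) S
    signedCount-⁻ u S = begin
      signedCount u (S ⁻)
        ≡⟨ ∑ˢ-insertAt e _ ⟩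
      ∑ˢ (λ T → [ u (T ⁻) ∧ (T ⁻ ⊆ᵇ S ⁻) ]· sign (T ⁻)) +
      ∑ˢ (λ T → [ u (T ⁺) ∧ (T ⁺ ⊆ᵇ S ⁻) ]· sign (T ⁺))
        ≡⟨ cong₂ _+_ (∑-cong (allSubsets n) same) (∑-zero (allSubsets n) none) ⟩
      signedCount (λ T → u (T ⁻)) S + 0ℤ
        ≡⟨ ℤₚ.+-identityʳ _ ⟩
      signedCount (λ T → u (T ⁻)) S ∎
      where
      open ≡-Reasoning
      same : ∀ T → [ u (T ⁻) ∧ (T ⁻ ⊆ᵇ S ⁻) ]· sign (T ⁻) ≡ [ u (T ⁻) ∧ (T ⊆ᵇ S) ]· sign T
      same T = cong₂ (λ c z → [ u (T ⁻) ∧ c ]· z)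
        (⊆ᵇ-insertAt T S e false false) (sign-insertAt-false T e)
      none : ∀ T → [ u (T ⁺) ∧ (T ⁺ ⊆ᵇ S ⁻) ]· sign (T ⁺) ≡ 0ℤ
      none T = cong (λ c → [ c ]· sign (T ⁺))
        (trans (cong (u (T ⁺) ∧_) (⊆ᵇ-insertAt T S e true false)) (∧-zeroʳ (u (T ⁺))))

    signedCount-⁺ : ∀ u S →
      signedCount u (S ⁺) ≡ signedCount (λ T → u (T ⁻)) S - signedCount (λ T → u (T ⁺)) S
    signedCount-⁺ u S = begin
      signedCount u (S ⁺)
        ≡⟨ ∑ˢ-insertAt e _ ⟩
      ∑ˢ (λ T → [ u (T ⁻) ∧ (T ⁻ ⊆ᵇ S ⁺) ]· sign (T ⁻)) +
      ∑ˢ (λ T → [ u (T ⁺) ∧ (T ⁺ ⊆ᵇ S ⁺) ]· sign (T ⁺))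
        ≡⟨ cong₂ _+_ (∑-cong (allSubsets n) same)
                     (trans (∑-cong (allSubsets n) flipped) (∑-neg (allSubsets n) _)) ⟩
      signedCount (λ T → u (T ⁻)) S - signedCount (λ T → u (T ⁺)) S ∎
      where
      open ≡-Reasoning
      same : ∀ T → [ u (T ⁻) ∧ (T ⁻ ⊆ᵇ S ⁺) ]· sign (T ⁻) ≡ [ u (T ⁻) ∧ (T ⊆ᵇ S) ]· sign T
      same T = cong₂ (λ c z → [ u (T ⁻) ∧ c ]· z)
        (⊆ᵇ-insertAt T S e false true) (sign-insertAt-false T e)
      flipped : ∀ T → [ u (T ⁺) ∧ (T ⁺ ⊆ᵇ S ⁺) ]· sign (T ⁺) ≡ - ([ u (T ⁺) ∧ (T ⊆ᵇ S) ]· sign T)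
      flipped T = trans (cong₂ (λ c z → [ u (T ⁺) ∧ c ]· z)
                                (⊆ᵇ-insertAt T S e true true) (sign-insertAt-true T e))
                        (sym ([]·-neg _ (sign T)))

    μ′-⁻ : ∀ u S → μ′ u (S ⁻) ≡ μ′ (λ T → u (T ⁻)) S
    μ′-⁻ u S = cong₂ (λ s c → - (s * c)) (sign-insertAt-false S e) (signedCount-⁻ u S)

    μ′-⁺ : ∀ u S → μ′ u (S ⁺) ≡ μ′ (λ T → u (T ⁺)) S - μ′ (λ T → u (T ⁻)) S
    μ′-⁺ u S = trans (cong₂ (λ s c → - (s * c)) (sign-insertAt-true S e) (signedCount-⁺ u S))
      (solve 3 (λ s a b → :- ((:- s) :* (a :- b)) := :- (s :* b) :- :- (s :* a)) refl (sign S) _ _)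

  W-term : ∀ {n} → (Subset n → ℕ) → ℤ → ℤ → Subset n → ℤ
  W-term ρ i p S = [ inS ρ i S ]· (μ ρ i S * (- p) ^ expo ρ i S)

  module _ {n} (ρ : Subset n → ℕ) (i p : ℤ) (S : Subset n) where

    W-term-inside : inS ρ i S ≡ true → W-term ρ i p S ≡ μ ρ i S * (- p) ^ expo ρ i S
    W-term-inside = cong (λ c → [ c ]· (μ ρ i S * (- p) ^ expo ρ i S))

    W-term-outside : inS ρ i S ≡ false → W-term ρ i p S ≡ 0ℤ
    W-term-outside = cong (λ c → [ c ]· (μ ρ i S * (- p) ^ expo ρ i S))

  rank-⊆ᵇ : ∀ {n} (M : Matroid n) {R T} → R ⊆ᵇ T ≡ true → rank M R ≤ rank M T
  rank-⊆ᵇ M {R} {T} R⊆T = rank-mono M (⊆ᵇ⇒⊆ R T R⊆T)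

  compl₁∪⁅⁆≡⊤ : ∀ {n} (e : Fin (suc n)) → compl₁ e ∪ ⁅ e ⁆ ≡ ⊤
  compl₁∪⁅⁆≡⊤         zero    = cong (true ∷_) (∪-identityʳ ⊤)
  compl₁∪⁅⁆≡⊤ {suc n} (suc e) = cong (true ∷_) (compl₁∪⁅⁆≡⊤ e)

  coloop⇒¬loop : ∀ {n} (M : Matroid (suc n)) e → IsColoop M e → ¬ IsLoop M e
  coloop⇒¬loop M e coloop loop = coloop (ℕₚ.≤-antisym (rank-mono M ⊆⊤) rk≤)
    where
    open ℕₚ.≤-Reasoning
    rk≤ : rk M ≤ rank M (compl₁ e)
    rk≤ = begin
      rk M                                                  ≡⟨ cong (rank M) (sym (compl₁∪⁅⁆≡⊤ e)) ⟩
      rank M (compl₁ e ∪ ⁅ e ⁆)                             ≤⟨ ℕₚ.m≤m+n _ _ ⟩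
      rank M (compl₁ e ∪ ⁅ e ⁆) ℕ.+ rank M (compl₁ e ∩ ⁅ e ⁆) ≤⟨ rank-submod M _ _ ⟩
      rank M (compl₁ e) ℕ.+ rank M ⁅ e ⁆                    ≡⟨ cong (rank M (compl₁ e) ℕ.+_) loop ⟩
      rank M (compl₁ e) ℕ.+ 0                               ≡⟨ ℕₚ.+-identityʳ _ ⟩
      rank M (compl₁ e)                                     ∎

  link⊎coloop⇒¬loop : ∀ {n} (M : Matroid (suc n)) e → IsLink M e ⊎ IsColoop M e → ¬ IsLoop M e
  link⊎coloop⇒¬loop M e (inj₁ (¬loop , _)) = ¬loop
  link⊎coloop⇒¬loop M e (inj₂ coloop)      = coloop⇒¬loop M e coloop

  module _ {n} (M : Matroid (suc n)) (e : Fin (suc n)) where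
    open Insertion e

    delRank-⊆ᵇ : ∀ {R T} → R ⊆ᵇ T ≡ true → delRank M e R ≤ delRank M e T
    delRank-⊆ᵇ {R} {T} R⊆T = rank-⊆ᵇ M (trans (⊆ᵇ-insertAt R T e false false) R⊆T)

    conRank-⊆ᵇ : ∀ {R T} → R ⊆ᵇ T ≡ true → conRank M e R ≤ conRank M e T
    conRank-⊆ᵇ {R} {T} R⊆T =
      ℕₚ.∸-monoˡ-≤ (rank M ⁅ e ⁆) (rank-⊆ᵇ M (trans (⊆ᵇ-insertAt R T e true true) R⊆T))

    rk≡rk-delete+b : rk M ≡ delRank M e ⊤ ℕ.+ b M e
    rk≡rk-delete+b = sym (ℕₚ.m+[n∸m]≡n (rank-mono M ⊆⊤))

    inS-⁻ : ∀ i S → inS (rank M) i (S ⁻) ≡ inS (delRank M e) (i - + b M e) S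
    inS-⁻ i S = ≤?-by-difference (trans (cong (λ d → + d - (+ rank M (S ⁻) + i)) rk≡rk-delete+b)
      (solve 4 (λ D B r j → (D :+ B) :- (r :+ j) := D :- (r :+ (j :- B))) refl
             (+ delRank M e ⊤) (+ b M e) (+ rank M (S ⁻)) i))

    expo-⁻ : ∀ i S → expo (rank M) i (S ⁻) ≡ expo (delRank M e) (i - + b M e) S
    expo-⁻ i S = cong ℤ.∣_∣
      (trans (cong₂ (λ s d → + s - + d + 1ℤ + i) (∣insertAt-false∣ S e) rk≡rk-delete+b)
             (solve 4 (λ s D B j → s :- (D :+ B) :+ con 1ℤ :+ j := s :- D :+ con 1ℤ :+ (j :- B)) refl
                    (+ ∣ S ∣) (+ delRank M e ⊤) (+ b M e) i))

    expo-⁺-suc : ∀ i S → inS (rank M) i (S ⁻) ≡ true →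
                 expo (rank M) i (S ⁺) ≡ suc (expo (rank M) i (S ⁻))
    expo-⁺-suc i S uS⁻ = trans (cong ℤ.∣_∣ shift) (∣i+1∣≡1+∣i∣ 0≤x)
      where
      x : ℤ
      x = + ∣ S ⁻ ∣ - + rk M + 1ℤ + i
      shift : + ∣ S ⁺ ∣ - + rk M + 1ℤ + i ≡ x + 1ℤ
      shift = trans
        (cong (λ s → + s - + rk M + 1ℤ + i)
              (trans (∣insertAt-true∣ S e) (cong suc (sym (∣insertAt-false∣ S e)))))
        (solve 3 (λ s D j → con 1ℤ :+ s :- D :+ con 1ℤ :+ j := s :- D :+ con 1ℤ :+ j :+ con 1ℤ) refl
               (+ ∣ S ⁻ ∣) (+ rk M) i)
      rk≤∣S⁻∣+i : + rk M ℤ.≤ + ∣ S ⁻ ∣ + i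
      rk≤∣S⁻∣+i = ℤₚ.≤-trans (toWitness (Equivalence.from T-≡ uS⁻)) (ℤₚ.+-monoˡ-≤ i (+≤+ (rank-≤ M (S ⁻))))
      0≤x : 0ℤ ℤ.≤ x
      0≤x = ℤₚ.≤-trans (+≤+ z≤n) (≤-by-difference
        (solve 3 (λ D s j → D :- (s :+ j) := con 1ℤ :- (s :- D :+ con 1ℤ :+ j)) refl (+ rk M) (+ ∣ S ⁻ ∣) i)
        rk≤∣S⁻∣+i)

    module _ (¬loop : ¬ IsLoop M e) where

      rank-⁅e⁆≡1 : rank M ⁅ e ⁆ ≡ 1
      rank-⁅e⁆≡1 =
        ℕₚ.≤-antisym (subst (rank M ⁅ e ⁆ ≤_) (∣⁅x⁆∣≡1 e) (rank-≤ M ⁅ e ⁆)) (ℕₚ.n≢0⇒n>0 ¬loop)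

      rank-⁺ : ∀ S → rank M (S ⁺) ≡ conRank M e S ℕ.+ 1
      rank-⁺ S = trans (sym (ℕₚ.m∸n+n≡m (rank-mono M ⁅e⁆⊆S⁺))) (cong (conRank M e S ℕ.+_) rank-⁅e⁆≡1)
        where
        ⁅e⁆⊆S⁺ : ⁅ e ⁆ ⊆ S ⁺
        ⁅e⁆⊆S⁺ x∈⁅e⁆ rewrite x∈⁅y⁆⇒x≡y e x∈⁅e⁆ = lookup⇒[]= e (S ⁺) (insertAt-lookup S e true)

      rk≡rk-contract+1 : rk M ≡ conRank M e ⊤ ℕ.+ 1
      rk≡rk-contract+1 = trans (cong (rank M) (sym (insertAt-⊤ e))) (rank-⁺ ⊤)

      inS-⁺ : ∀ i S → inS (rank M) i (S ⁺) ≡ inS (conRank M e) i S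
      inS-⁺ i S = ≤?-by-difference
        (trans (cong₂ (λ d r → + d - (+ r + i)) rk≡rk-contract+1 (rank-⁺ S))
               (solve 3 (λ D r j → (D :+ con 1ℤ) :- ((r :+ con 1ℤ) :+ j) := D :- (r :+ j)) refl
                      (+ conRank M e ⊤) (+ conRank M e S) i))

      expo-⁺ : ∀ i S → expo (rank M) i (S ⁺) ≡ expo (conRank M e) i S
      expo-⁺ i S = cong ℤ.∣_∣
        (trans (cong₂ (λ s d → + s - + d + 1ℤ + i) (∣insertAt-true∣ S e) rk≡rk-contract+1)
               (solve 3 (λ s D j → con 1ℤ :+ s :- (D :+ con 1ℤ) :+ con 1ℤ :+ j := s :- D :+ con 1ℤ :+ j) refl
                      (+ ∣ S ∣) (+ conRank M e ⊤) i))

      module _ (i p : ℤ) where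

        private
          iD : ℤ
          iD = i - + b M e

          upM : UpClosed (inS (rank M) i)
          upM = inS-upClosed (rank M) (rank-⊆ᵇ M) i

          upD : UpClosed (inS (delRank M e) iD)
          upD = inS-upClosed (delRank M e) delRank-⊆ᵇ iD

          upC : UpClosed (inS (conRank M e) i)
          upC = inS-upClosed (conRank M e) conRank-⊆ᵇ i

        μ-⁻ : ∀ S → inS (delRank M e) iD S ≡ true → μ (rank M) i (S ⁻) ≡ μ (delRank M e) iD S
        μ-⁻ S uD = begin
          μ (rank M) i (S ⁻)                 ≡⟨ μ≡μ′ (rank M) i upM (S ⁻) (trans (inS-⁻ i S) uD) ⟩
          μ′ (inS (rank M) i) (S ⁻)          ≡⟨ μ′-⁻ (inS (rank M) i) S ⟩
          μ′ (λ T → inS (rank M) i (T ⁻)) S ≡⟨ μ′-cong (inS-⁻ i) S ⟩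
          μ′ (inS (delRank M e) iD) S        ≡⟨ sym (μ≡μ′ (delRank M e) iD upD S uD) ⟩
          μ (delRank M e) iD S               ∎
          where open ≡-Reasoning

        μ-⁺ : ∀ S → inS (conRank M e) i S ≡ true →
              μ (rank M) i (S ⁺) ≡ μ′ (inS (conRank M e) i) S - μ′ (inS (delRank M e) iD) S
        μ-⁺ S uC = begin
          μ (rank M) i (S ⁺)
            ≡⟨ μ≡μ′ (rank M) i upM (S ⁺) (trans (inS-⁺ i S) uC) ⟩
          μ′ (inS (rank M) i) (S ⁺)
            ≡⟨ μ′-⁺ (inS (rank M) i) S ⟩
          μ′ (λ T → inS (rank M) i (T ⁺)) S - μ′ (λ T → inS (rank M) i (T ⁻)) S
            ≡⟨ cong₂ _-_ (μ′-cong (inS-⁺ i) S) (μ′-cong (inS-⁻ i) S) ⟩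
          μ′ (inS (conRank M e) i) S - μ′ (inS (delRank M e) iD) S ∎
          where open ≡-Reasoning

        W-term-⁻ : ∀ S → W-term (rank M) i p (S ⁻) ≡ W-term (delRank M e) iD p S
        W-term-⁻ S =
          []·-cong (inS-⁻ i S) (λ uD → cong₂ (λ m k → m * (- p) ^ k) (μ-⁻ S uD) (expo-⁻ i S))

        W-term-⁺-outside : ∀ S → inS (delRank M e) iD S ≡ false →
          W-term (rank M) i p (S ⁺) ≡ W-term (conRank M e) i p S + p * W-term (delRank M e) iD p S
        W-term-⁺-outside S uD = begin
          W-term (rank M) i p (S ⁺)
            ≡⟨ []·-cong (inS-⁺ i S) (λ uC → cong₂ (λ m k → m * (- p) ^ k) (μ-⁺-outside uC) (expo-⁺ i S)) ⟩
          W-term (conRank M e) i p S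
            ≡⟨ sym (ℤₚ.+-identityʳ _) ⟩
          W-term (conRank M e) i p S + 0ℤ
            ≡⟨ cong (_+_ (W-term (conRank M e) i p S)) (sym p*0≡0) ⟩
          W-term (conRank M e) i p S + p * W-term (delRank M e) iD p S ∎
          where
          open ≡-Reasoning
          p*0≡0 : p * W-term (delRank M e) iD p S ≡ 0ℤ
          p*0≡0 = trans (cong (p *_) (W-term-outside (delRank M e) iD p S uD)) (ℤₚ.*-zeroʳ p)
          μ-⁺-outside : inS (conRank M e) i S ≡ true → μ (rank M) i (S ⁺) ≡ μ (conRank M e) i S
          μ-⁺-outside uC = begin
            μ (rank M) i (S ⁺)
              ≡⟨ μ-⁺ S uC ⟩
            μ′ (inS (conRank M e) i) S - μ′ (inS (delRank M e) iD) S
              ≡⟨ cong (_-_ (μ′ (inS (conRank M e) i) S)) (μ′-outside {u = inS (delRank M e) iD} upD uD) ⟩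
            μ′ (inS (conRank M e) i) S - 0ℤ
              ≡⟨ ℤₚ.+-identityʳ _ ⟩
            μ′ (inS (conRank M e) i) S
              ≡⟨ sym (μ≡μ′ (conRank M e) i upC S uC) ⟩
            μ (conRank M e) i S ∎

        W-term-⁺-inside : ∀ S → inS (delRank M e) iD S ≡ true →
          W-term (rank M) i p (S ⁺) ≡ W-term (conRank M e) i p S + p * W-term (delRank M e) iD p S
        W-term-⁺-inside S uD = begin
          W-term (rank M) i p (S ⁺)
            ≡⟨ W-term-inside (rank M) i p (S ⁺) (trans (inS-⁺ i S) uC) ⟩
          μ (rank M) i (S ⁺) * x ^ expo (rank M) i (S ⁺)
            ≡⟨ cong₂ (λ m k → m * x ^ k) μ-split (expo-⁺ i S) ⟩
          (μC - μD) * x ^ expoC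
            ≡⟨ cong (λ k → (μC - μD) * x ^ k) expoC≡1+expoD ⟩
          (μC - μD) * (x * x ^ expoD)
            ≡⟨ solve 4 (λ c d q y → (c :- d) :* ((:- q) :* y) := c :* ((:- q) :* y) :+ q :* (d :* y))
                     refl μC μD p (x ^ expoD) ⟩
          μC * (x * x ^ expoD) + p * (μD * x ^ expoD)
            ≡⟨ cong (λ k → μC * x ^ k + p * (μD * x ^ expoD)) (sym expoC≡1+expoD) ⟩
          μC * x ^ expoC + p * (μD * x ^ expoD)
            ≡⟨ sym (cong₂ _+_ (W-term-inside (conRank M e) i p S uC)
                              (cong (p *_) (W-term-inside (delRank M e) iD p S uD))) ⟩
          W-term (conRank M e) i p S + p * W-term (delRank M e) iD p S ∎
          where
          open ≡-Reasoning
          x μC μD : ℤ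
          x = - p
          μC = μ (conRank M e) i S
          μD = μ (delRank M e) iD S
          expoC expoD : ℕ
          expoC = expo (conRank M e) i S
          expoD = expo (delRank M e) iD S
          uC : inS (conRank M e) i S ≡ true
          uC = trans (sym (inS-⁺ i S))
                     (upM (trans (inS-⁻ i S) uD) (trans (⊆ᵇ-insertAt S S e false true) (⊆ᵇ-refl S)))
          μ-split : μ (rank M) i (S ⁺) ≡ μC - μD
          μ-split = trans (μ-⁺ S uC)
            (sym (cong₂ _-_ (μ≡μ′ (conRank M e) i upC S uC) (μ≡μ′ (delRank M e) iD upD S uD)))
          expoC≡1+expoD : expoC ≡ suc expoD
          expoC≡1+expoD = trans (sym (expo-⁺ i S))
            (trans (expo-⁺-suc i S (trans (inS-⁻ i S) uD)) (cong suc (expo-⁻ i S)))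

        W-term-⁺ : ∀ S →
          W-term (rank M) i p (S ⁺) ≡ W-term (conRank M e) i p S + p * W-term (delRank M e) iD p S
        W-term-⁺ S = by-membership (inS (delRank M e) iD S) refl
          where
          by-membership : ∀ c → inS (delRank M e) iD S ≡ c →
            W-term (rank M) i p (S ⁺) ≡ W-term (conRank M e) i p S + p * W-term (delRank M e) iD p S
          by-membership false = W-term-⁺-outside S
          by-membership true  = W-term-⁺-inside S

        W-deletion-contraction : W (rank M) i p ≡ (1ℤ + p) * W (delRank M e) iD p + W (conRank M e) i p
        W-deletion-contraction = begin
          W (rank M) i p
            ≡⟨ ∑ˢ-insertAt e (W-term (rank M) i p) ⟩
          ∑ˢ (λ S → W-term (rank M) i p (S ⁻)) + ∑ˢ (λ S → W-term (rank M) i p (S ⁺))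
            ≡⟨ cong₂ _+_ (∑-cong (allSubsets n) W-term-⁻) (∑-cong (allSubsets n) W-term-⁺) ⟩
          WD + ∑ˢ (λ S → W-term (conRank M e) i p S + p * W-term (delRank M e) iD p S)
            ≡⟨ cong (_+_ WD) (trans (∑-+ (allSubsets n) _ _) (cong (_+_ WC) (∑-*ˡ (allSubsets n) p _))) ⟩
          WD + (WC + p * WD)
            ≡⟨ solve 3 (λ d c q → d :+ (c :+ q :* d) := (con 1ℤ :+ q) :* d :+ c) refl WD WC p ⟩
          (1ℤ + p) * WD + WC ∎
          where
          open ≡-Reasoning
          WD WC : ℤ
          WD = W (delRank M e) iD p
          WC = W (conRank M e) i p

open import Data.Nat using (ℕ; suc; _+_; _≤_)
open import Data.Integer using (ℤ; +_; _-_) renaming (_+_ to _+ℤ_; _*_ to _*ℤ_)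
open import Data.Fin using (Fin)
open import Data.Sum using (_⊎_)
open import Relation.Binary.PropositionalEquality using (_≡_)
open DeletionContraction using (W-deletion-contraction; link⊎coloop⇒¬loop)

lemma2p5 : ∀ {n} (M : Matroid (suc n)) (i : ℕ) (e : Fin (suc n)) →
    2 ≤ rk M → i + 2 ≤ rk M → IsLink M e ⊎ IsColoop M e →
    ∀ (p : ℤ) →
    W (rank M) (+ i) p
      ≡ ((+ 1 +ℤ p) *ℤ W (delRank M e) (+ i - + b M e) p) +ℤ W (conRank M e) (+ i) p
lemma2p5 M i e _ _ link⊎coloop p = W-deletion-contraction M e (link⊎coloop⇒¬loop M e link⊎coloop) (+ i) p
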